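{- For every type $T$ of the Scalar type system there exist a unit type $U$ and a scalar $\alpha\in\mathcal{S}$ such that $T\equiv\alpha.U$.
   Context: Scalars form a commutative ring $(\mathcal{S},+,\times)$. Types $T::=U\mid\forall X.T\mid\alpha.T\mid\overline{0}$; unit types $U::=X\mid U\to T\mid\forall X.U$ ($X$ type variables, $\alpha\in\mathcal{S}$). $\equiv$ is the least congruence on types with $\alpha.\overline{0}\equiv\overline{0}$, $0.T\equiv\overline{0}$, $1.T\equiv T$, $\alpha.(\beta.T)\equiv(\alpha\times\beta).T$, $\forall X.\alpha.T\equiv\alpha.\forall X.T$. -}

module Defs where

open import Level using (_⊔_)
open import Data.Nat using (ℕ)
open import Algebra.Bundles using (CommutativeRing)

TVar : Set
TVar = ℕ

module _ {c ℓ} (R : CommutativeRing c ℓ) where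
  open CommutativeRing R renaming (Carrier to 𝒮)

  mutual
    data Type : Set c where
      unit : Unit → Type
      ∀ᵀ   : TVar → Type → Type
      _·_  : 𝒮 → Type → Type
      𝟘    : Type

    data Unit : Set c where
      var  : TVar → Unit
      _⇒_  : Unit → Type → Unit
      ∀ᵁ   : TVar → Unit → Unit

  infixr 6 _·_
  infix 4 _≡ᵀ_

  data _≡ᵀ_ : Type → Type → Set (c ⊔ ℓ) where
    ≡-refl  : ∀ {T} → T ≡ᵀ T
    ≡-sym   : ∀ {T T′} → T ≡ᵀ T′ → T′ ≡ᵀ T
    ≡-trans : ∀ {T T′ T″} → T ≡ᵀ T′ → T′ ≡ᵀ T″ → T ≡ᵀ T″
    ax-α𝟘   : ∀ {α} → α · 𝟘 ≡ᵀ 𝟘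
    ax-0T   : ∀ {T} → 0# · T ≡ᵀ 𝟘
    ax-1T   : ∀ {T} → 1# · T ≡ᵀ T
    ax-αβ   : ∀ {α β T} → α · (β · T) ≡ᵀ (α * β) · T
    ax-∀α   : ∀ {X α T} → ∀ᵀ X (α · T) ≡ᵀ α · ∀ᵀ X T
    -- ∀X.U as a unit type and as a general type are the same syntactic object
    ∀-unit  : ∀ {X U} → unit (∀ᵁ X U) ≡ᵀ ∀ᵀ X (unit U)
    ·-scal  : ∀ {α β T} → α ≈ β → α · T ≡ᵀ β · T
    ·-cong  : ∀ {α T T′} → T ≡ᵀ T′ → α · T ≡ᵀ α · T′
    ∀ᵀ-cong : ∀ {X T T′} → T ≡ᵀ T′ → ∀ᵀ X T ≡ᵀ ∀ᵀ X T′
    ∀ᵁ-cong : ∀ {X U U′} → unit U ≡ᵀ unit U′ → unit (∀ᵁ X U) ≡ᵀ unit (∀ᵁ X U′)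
    ⇒-congˡ : ∀ {U U′ T} → unit U ≡ᵀ unit U′ → unit (U ⇒ T) ≡ᵀ unit (U′ ⇒ T)
    ⇒-congʳ : ∀ {U T T′} → T ≡ᵀ T′ → unit (U ⇒ T) ≡ᵀ unit (U ⇒ T′)

-- Induction on T: a unit type is 1 times itself, 0̄ is 0 times any unit type,
-- and both α.− and ∀X.− preserve the shape α.U, the latter because ∀X
-- commutes with scalars and ∀X.U is again a unit type.
module Submission where

open import Defs
open import Algebra.Bundles using (CommutativeRing)
open import Data.Product using (∃₂; _,_)

module UnitDecomposition {c ℓ} (R : CommutativeRing c ℓ) where
  open CommutativeRing R using (_*_; 0#; 1#) renaming (Carrier to 𝒮)

  ·-scaled : ∀ {T U α} β → _≡ᵀ_ R T (α · unit U) → _≡ᵀ_ R (β · T) ((β * α) · unit U)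
  ·-scaled β T≡αU = ≡-trans (·-cong T≡αU) ax-αβ

  ∀ᵀ-scaled : ∀ {T U α} X → _≡ᵀ_ R T (α · unit U) → _≡ᵀ_ R (∀ᵀ X T) (α · unit (∀ᵁ X U))
  ∀ᵀ-scaled X T≡αU = ≡-trans (∀ᵀ-cong T≡αU) (≡-trans ax-∀α (·-cong (≡-sym ∀-unit)))

  scaledUnit : (T : Type R) → ∃₂ λ (U : Unit R) (α : 𝒮) → _≡ᵀ_ R T (α · unit U)
  scaledUnit (unit U) = U , 1# , ≡-sym ax-1T
  scaledUnit (∀ᵀ X T) with scaledUnit T
  ... | U , α , T≡αU = ∀ᵁ X U , α , ∀ᵀ-scaled X T≡αU
  scaledUnit (β · T) with scaledUnit T
  ... | U , α , T≡αU = U , β * α , ·-scaled β T≡αU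
  scaledUnit 𝟘 = var 0 , 0# , ≡-sym ax-0T

mainTheorem7 : ∀ {c ℓ} (R : CommutativeRing c ℓ) (T : Type R) →
    ∃₂ λ (U : Unit R) (α : CommutativeRing.Carrier R) → _≡ᵀ_ R T (α · unit U)
mainTheorem7 R = UnitDecomposition.scaledUnit R
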